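{- Consider the two-player guessing game on a finite connected simple graph $G=(V,E)$, in either the simultaneous or the alternating variant. Suppose the players follow a correct strategy. Let $(a,b)$ be a placement (so $\{a,b\}\in E$, $A$ sits at $a$, $B$ sits at $b$) in which player $A$ announces their position at step $n$, and player $B$ has announced nothing at any step before $n$. Then for every vertex $a'\neq a$ adjacent to $b$, in the placement $(a',b)$ player $B$ announces their (correct) position at some step $\le n-1$.
   Context: The game: $G=(V,E)$ is a finite connected simple graph. Two players $A$ and $B$ are placed on the endpoints of an edge; a placement is an ordered pair $(a,b)$ with $\{a,b\}\in E$, meaning $A$ sits at $a$ and $B$ at $b$. Each player knows $G$ and the vertex of the other player, but not their own vertex. Time proceeds in discrete steps $t=1,2,\dots$. In the simultaneous variant, at each step each player either stays silent or announces a vertex (claiming it is their own position), both acting at the same time. In the alternating variant, $A$ may speak only at odd steps and $B$ only at even steps. All announcements are heard by both players. A strategy specifies for each player, as a function of $G$, the other player's vertex and the history of announcements so far, whether to stay silent or which vertex to announce at each step (the players may have agreed on it in advance). A strategy is correct if in every placement, whenever a player announces a vertex, it is that player's actual position. -}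

module Defs where

open import Data.Nat using (ℕ; zero; suc; _≤_; _<_)
open import Data.Fin using (Fin)
open import Data.Bool using (Bool; true; false; not)
open import Data.Maybe using (Maybe; just; nothing)
open import Data.List using (List; []; _∷_)
open import Data.Product using (_×_; _,_; proj₁; proj₂; ∃)
open import Relation.Binary.PropositionalEquality using (_≡_)
open import Relation.Nullary using (¬_)

record SimpleGraph (n : ℕ) : Set₁ where
  field
    Adj     : Fin n → Fin n → Set
    symm    : ∀ {u v} → Adj u v → Adj v u
    irrefl  : ∀ {v} → ¬ Adj v v

module _ {n : ℕ} (G : SimpleGraph n) where
  open SimpleGraph G

  data Reachable : Fin n → Fin n → Set where
    here  : ∀ {v} → Reachable v v
    step  : ∀ {u v w} → Adj u v → Reachable v w → Reachable u w

  Connected : Set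
  Connected = ∀ u v → Reachable u v

data Variant : Set where
  simultaneous alternating : Variant

-- An action at one step: silence (nothing) or announcing a vertex (just v).
-- A history records the pair (A's action , B's action) of every step done
-- so far, most recent step first.
History : ℕ → Set
History n = List (Maybe (Fin n) × Maybe (Fin n))

-- A strategy for a player: given the other player's vertex and the
-- history of announcements so far, stay silent or announce a vertex.
-- (The graph is fixed, so dependence on G is implicit.)
PlayerStrategy : ℕ → Set
PlayerStrategy n = Fin n → History n → Maybe (Fin n)

record Strategy (n : ℕ) : Set where
  field
    σA : PlayerStrategy n
    σB : PlayerStrategy n

isOdd : ℕ → Bool
isOdd zero    = false
isOdd (suc t) = not (isOdd t)

mayA : Variant → ℕ → Bool
mayA simultaneous t = true
mayA alternating  t = isOdd t

mayB : Variant → ℕ → Bool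
mayB simultaneous t = true
mayB alternating  t = not (isOdd t)

mask : ∀ {n} → Bool → Maybe (Fin n) → Maybe (Fin n)
mask true  m = m
mask false m = nothing

module Play {n : ℕ} (v : Variant) (S : Strategy n) (a b : Fin n) where
  open Strategy S

  -- history k : the actions of steps 1..k (most recent first)
  -- acts t    : the pair of actions at step t (t ≥ 1); acts 0 is a dummy
  --             silent pair, there is no step 0.
  history : ℕ → History n
  acts    : ℕ → Maybe (Fin n) × Maybe (Fin n)

  history zero    = []
  history (suc k) = acts (suc k) ∷ history k

  acts zero    = nothing , nothing
  acts (suc k) = mask (mayA v (suc k)) (σA b (history k))
               , mask (mayB v (suc k)) (σB a (history k))

saysA : ∀ {n} → Variant → Strategy n → Fin n → Fin n → ℕ → Maybe (Fin n)
saysA v S a b t = proj₁ (Play.acts v S a b t)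

saysB : ∀ {n} → Variant → Strategy n → Fin n → Fin n → ℕ → Maybe (Fin n)
saysB v S a b t = proj₂ (Play.acts v S a b t)

Correct : ∀ {n} → SimpleGraph n → Variant → Strategy n → Set
Correct {n} G v S =
  ∀ (a b : Fin n) → SimpleGraph.Adj G a b → ∀ (t : ℕ) → 1 ≤ t →
    (∀ x → saysA v S a b t ≡ just x → x ≡ a) ×
    (∀ y → saysB v S a b t ≡ just y → y ≡ b)

module Submission where

open import Defs
open import Data.Nat using (ℕ; zero; suc; _≤_; _<_; _∸_; s≤s; s≤s⁻¹; z≤n)
open import Data.Nat.Properties using (m<n⇒m<1+n; m<1+n⇒m<n∨m≡n; n<1+n)
open import Data.Fin using (Fin)
open import Data.Maybe using (Maybe; just; nothing)
open import Data.Product using (_×_; ∃; ∃₂; _,_; proj₁; proj₂)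
open import Data.Sum using (_⊎_; inj₁; inj₂)
open import Data.List using (_∷_)
open import Relation.Binary.PropositionalEquality
  using (_≡_; _≢_; refl; sym; trans; cong; cong₂)
open import Relation.Nullary using (contradiction)

-- A's rule only sees B's vertex and the history, and the histories of the
-- placements (a , b) and (a′ , b) can only differ through B's announcements.
-- So were B silent before step n in (a′ , b) too, A would make the same
-- announcement at step n in both placements, which correctness forbids as a ≢ a′.

SilentBefore : {A : Set} → (ℕ → Maybe A) → ℕ → Set
SilentBefore f n = ∀ t → 1 ≤ t → t < n → f t ≡ nothing

SpeaksBefore : {A : Set} → (ℕ → Maybe A) → ℕ → Set
SpeaksBefore f n = ∃₂ λ t y → 1 ≤ t × t < n × f t ≡ just y

speaksBefore⊎silentBefore : {A : Set} (f : ℕ → Maybe A) (n : ℕ) →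
  SpeaksBefore f n ⊎ SilentBefore f n
speaksBefore⊎silentBefore f zero          = inj₂ λ _ _ ()
speaksBefore⊎silentBefore f (suc zero)    = inj₂ λ { _ (s≤s _) (s≤s ()) }
speaksBefore⊎silentBefore f (suc (suc n)) with speaksBefore⊎silentBefore f (suc n)
... | inj₁ (t , y , 1≤t , t<n , ft≡y) = inj₁ (t , y , 1≤t , m<n⇒m<1+n t<n , ft≡y)
... | inj₂ silent with f (suc n) in fn≡
...   | just y  = inj₁ (suc n , y , s≤s z≤n , n<1+n (suc n) , fn≡)
...   | nothing = inj₂ silent′
  where
  silent′ : SilentBefore f (suc (suc n))
  silent′ t 1≤t t<n+2 with m<1+n⇒m<n∨m≡n t<n+2
  ... | inj₁ t<n+1 = silent t 1≤t t<n+1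
  ... | inj₂ refl  = fn≡

module _ {N : ℕ} (v : Variant) (S : Strategy N) (a a′ b : Fin N) where
  open Strategy S
  open Play v S using (history)

  history-≡-while-B-silent : ∀ k →
    SilentBefore (saysB v S a b) (suc k) → SilentBefore (saysB v S a′ b) (suc k) →
    history a b k ≡ history a′ b k
  history-≡-while-B-silent zero    _      _       = refl
  history-≡-while-B-silent (suc k) silent silent′ =
    cong₂ _∷_ (cong₂ _,_ (cong (λ h → mask (mayA v (suc k)) (σA b h)) ih)
                         (trans (silent (suc k) (s≤s z≤n) (n<1+n (suc k)))
                                (sym (silent′ (suc k) (s≤s z≤n) (n<1+n (suc k))))))
              ih
    where
    ih : history a b k ≡ history a′ b k
    ih = history-≡-while-B-silent k (λ t 1≤t t<k → silent t 1≤t (m<n⇒m<1+n t<k))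
                                    (λ t 1≤t t<k → silent′ t 1≤t (m<n⇒m<1+n t<k))

  saysA-≡-while-B-silent : ∀ k →
    SilentBefore (saysB v S a b) (suc k) → SilentBefore (saysB v S a′ b) (suc k) →
    saysA v S a b (suc k) ≡ saysA v S a′ b (suc k)
  saysA-≡-while-B-silent k silent silent′ =
    cong (λ h → mask (mayA v (suc k)) (σA b h)) (history-≡-while-B-silent k silent silent′)

lemma2p1 : ∀ {N : ℕ} (G : SimpleGraph N) → Connected G →
    (v : Variant) (S : Strategy N) → Correct G v S →
    (a b : Fin N) → SimpleGraph.Adj G a b →
    (n : ℕ) → 1 ≤ n →
    (∃ λ x → saysA v S a b n ≡ just x) →
    (∀ t → 1 ≤ t → t < n → saysB v S a b t ≡ nothing) →
    ∀ (a′ : Fin N) → a′ ≢ a → SimpleGraph.Adj G a′ b →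
      ∃ λ t → 1 ≤ t × t ≤ n ∸ 1 × saysB v S a′ b t ≡ just b
lemma2p1 G _ v S correct a b ab (suc m) _ (x , saysA≡x) silent a′ a′≢a a′b
  with speaksBefore⊎silentBefore (saysB v S a′ b) (suc m)
... | inj₁ (t , y , 1≤t , t<n , saysB≡y) =
  t , 1≤t , s≤s⁻¹ t<n , trans saysB≡y (cong just (proj₂ (correct a′ b a′b t 1≤t) y saysB≡y))
... | inj₂ silent′ = contradiction (trans (sym x≡a′) x≡a) a′≢a
  where
  x≡a : x ≡ a
  x≡a = proj₁ (correct a b ab (suc m) (s≤s z≤n)) x saysA≡x
  x≡a′ : x ≡ a′
  x≡a′ = proj₁ (correct a′ b a′b (suc m) (s≤s z≤n)) x
           (trans (sym (saysA-≡-while-B-silent v S a a′ b m silent silent′)) saysA≡x)
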